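{- For all integers $m,n\ge 2$ with $mn>4$, $\pi^\circ(K_{m,n})=2$.
   Context: Two edges are nonincident if they share no endpoint. A circular ordering of $V(G)$ separates a pair $\{xy,zw\}$ of nonincident edges if the endpoints of the two edges do not alternate around the cycle. The circular separation dimension $\pi^\circ(G)$ is the minimum number of circular orderings of $V(G)$ such that every pair of nonincident edges is separated by at least one of them. $K_{m,n}$ is the complete bipartite graph with parts of sizes $m$ and $n$. -}

module Defs where

open import Data.Nat using (ℕ; _<_; _+_; _*_; _⊔_; _⊓_)
open import Data.Fin using (Fin; toℕ; splitAt)
open import Data.Fin.Permutation using (Permutation′; _⟨$⟩ʳ_)
open import Data.Vec using (Vec; lookup)
open import Data.Bool using (Bool; true; false)
open import Data.Sum using (_⊎_; inj₁; inj₂)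
open import Data.Product using (_×_; Σ; ∃)
open import Relation.Nullary using (¬_)
open import Relation.Binary.PropositionalEquality using (_≡_; _≢_)

record Graph (N : ℕ) : Set₁ where
  field
    Adj     : Fin N → Fin N → Set
    symAdj  : ∀ {x y} → Adj x y → Adj y x
    irrAdj  : ∀ {x} → ¬ Adj x x
open Graph public

inFirstPart : (m : ℕ) {n : ℕ} → Fin (m + n) → Bool
inFirstPart m i with splitAt m i
... | inj₁ _ = true
... | inj₂ _ = false

K : (m n : ℕ) → Graph (m + n)
K m n = record
  { Adj    = λ i j → inFirstPart m i ≢ inFirstPart m j
  ; symAdj = λ p q → p (sym′ q)
  ; irrAdj = λ p → p refl′
  }
  where
    open import Relation.Binary.PropositionalEquality using () renaming (sym to sym′; refl to refl′)

-- A circular ordering of V(G) = Fin N: a bijection assigning each vertex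
-- a position 0..N-1, read cyclically.
CircOrder : ℕ → Set
CircOrder N = Permutation′ N

StrictlyBetween : ℕ → ℕ → ℕ → Set
StrictlyBetween a b c = (a ⊓ b) < c × c < (a ⊔ b)

Alternate : ∀ {N} → CircOrder N → (x y z w : Fin N) → Set
Alternate σ x y z w =
  (B z × ¬ B w) ⊎ (¬ B z × B w)
  where
    pos : Fin _ → ℕ
    pos v = toℕ (σ ⟨$⟩ʳ v)
    B : Fin _ → Set
    B v = StrictlyBetween (pos x) (pos y) (pos v)

Separates : ∀ {N} → CircOrder N → (x y z w : Fin N) → Set
Separates σ x y z w = ¬ Alternate σ x y z w

NonincidentEdges : ∀ {N} → Graph N → (x y z w : Fin N) → Set
NonincidentEdges G x y z w =
  Adj G x y × Adj G z w × x ≢ z × x ≢ w × y ≢ z × y ≢ w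

IsCircSepFamily : ∀ {N k} → Graph N → Vec (CircOrder N) k → Set
IsCircSepFamily {N} {k} G σs =
  ∀ (x y z w : Fin N) → NonincidentEdges G x y z w →
    ∃ λ (i : Fin k) → Separates (lookup σs i) x y z w

HasCircSepFamilyOfSize : ∀ {N} → Graph N → ℕ → Set
HasCircSepFamilyOfSize {N} G k = Σ (Vec (CircOrder N) k) (IsCircSepFamily G)

CircSepDim≡ : ∀ {N} → Graph N → ℕ → Set
CircSepDim≡ G d =
  HasCircSepFamilyOfSize G d × (∀ k → k < d → ¬ HasCircSepFamilyOfSize G k)

-- For c ∉ {a, b}, c lies strictly
-- between a and b iff exactly one of a, b is below c, so {ab, cd} alternate iff the parity
-- [a<c] + [b<c] + [a<d] + [b<d] is odd. Summed over the three ways of pairing up four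
-- distinct positions, every comparison cancels except three that occur once in each
-- direction, so the total is odd: if {ab, cd} does not alternate, then {ac, bd} or {ad, bc} does.
--
-- Lower bound: mn > 4 with m, n ≥ 2 gives a K₂,₃ with parts {u₁, u₂} and {c₁, c₂, c₃}. In a
-- single ordering two of the cᵢ lie on the same side of the chord u₁u₂, and then one of the
-- two pairs of nonincident edges of the 4-cycle through u₁, u₂ and those two alternates.
--
-- Upper bound: list the first part in order followed by the second part, once increasing and
-- once decreasing. Edges ij and kl with j ≠ l alternate in the first ordering iff
-- [i<k] = [j<l] and in the second iff [i<k] ≠ [j<l], so one of the two separates them.

module Submission where

open import Defs
open import Data.Nat using (ℕ; _≤_; _<_; _*_; zero; suc; _+_; _⊓_; _⊔_; _<ᵇ_; _≤?_; z≤n; s≤s)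
open import Data.Bool using (Bool; true; false; not; _xor_)
open import Data.Bool.Properties using (xor-same; xor-comm; xor-identityʳ; not-distribʳ-xor; not-involutive)
open import Data.Bool.Solver using (module xor-∧-Solver)
open import Data.Empty using (⊥-elim)
open import Data.Fin using (Fin; toℕ; splitAt; inject≤; opposite; _↑ˡ_; _↑ʳ_)
open import Data.Fin.Patterns using (0F; 1F)
open import Data.Fin.Permutation using (Permutation′; _⟨$⟩ʳ_; id; reverse)
open import Data.Fin.Properties
  using (toℕ-injective; toℕ<n; toℕ-↑ˡ; toℕ-↑ʳ; ↑ˡ-injective; ↑ʳ-injective; inject≤-injective;
         splitAt-↑ˡ; splitAt-↑ʳ; splitAt⁻¹-↑ˡ; splitAt⁻¹-↑ʳ; opposite-prop; +↔⊎; 2↔Bool; pigeonhole; ¬Fin0)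
  renaming (<⇒≢ to <⇒≢ᶠ)
open import Data.Nat.Properties
  using (<-cmp; <⇒≤; ≤⇒≯; ≮⇒≥; ≰⇒>; ≤∧≢⇒<; ≤-pred; ≤-trans; ≤-<-trans; <-≤-trans; m≤m+n;
         m⊓n≤m; m⊓n≤n; m≤m⊔n; m≤n⊔m; ⊓-glb; ⊔-lub; *-mono-≤; ∸-monoʳ-<; <ᵇ-reflects-<)
open import Data.Product using (_×_; _,_; proj₁; ∃; ∃₂; map₂)
open import Data.Sum using (_⊎_; inj₁; inj₂; [_,_]′)
open import Data.Sum.Function.Propositional using (_⊎-↔_)
open import Data.Vec using (Vec; []; _∷_; lookup)
open import Function using (_∘_)
open import Function.Bundles using (Inverse; Injection)
open import Function.Definitions using (Injective)
open import Function.Properties.Inverse using (↔-trans; ↔-sym; ↔-refl; ↔⇒↣)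
open import Relation.Binary using (tri<; tri≈; tri>)
open import Relation.Binary.PropositionalEquality
  using (_≡_; _≢_; refl; sym; trans; cong; cong₂; subst; module ≡-Reasoning)
open import Relation.Nullary using (¬_; yes; no; contradiction)
open import Relation.Nullary.Reflects using (Reflects; ofʸ; ofⁿ; det; invert)

<ᵇ-true : ∀ {a b} → a < b → (a <ᵇ b) ≡ true
<ᵇ-true a<b = det (<ᵇ-reflects-< _ _) (ofʸ a<b)

<ᵇ-false : ∀ {a b} → b ≤ a → (a <ᵇ b) ≡ false
<ᵇ-false b≤a = det (<ᵇ-reflects-< _ _) (ofⁿ (≤⇒≯ b≤a))

<ᵇ-flip : ∀ {a b} → a ≢ b → (b <ᵇ a) ≡ not (a <ᵇ b)
<ᵇ-flip {a} {b} a≢b with <-cmp a b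
... | tri< a<b _ _ = trans (<ᵇ-false (<⇒≤ a<b)) (cong not (sym (<ᵇ-true a<b)))
... | tri≈ _ a≡b _ = ⊥-elim (a≢b a≡b)
... | tri> _ _ b<a = trans (<ᵇ-true b<a) (cong not (sym (<ᵇ-false (<⇒≤ b<a))))

+-<ᵇ : ∀ k {a b} → (k + a <ᵇ k + b) ≡ (a <ᵇ b)
+-<ᵇ zero    = refl
+-<ᵇ (suc k) = +-<ᵇ k

opposite-reverses-< : ∀ {n} {j l : Fin n} → toℕ j < toℕ l → toℕ (opposite l) < toℕ (opposite j)
opposite-reverses-< {j = j} {l} j<l
  rewrite opposite-prop j | opposite-prop l = ∸-monoʳ-< (s≤s j<l) (toℕ<n l)

opposite-<ᵇ : ∀ {n} {j l : Fin n} → j ≢ l →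
              (toℕ (opposite j) <ᵇ toℕ (opposite l)) ≡ not (toℕ j <ᵇ toℕ l)
opposite-<ᵇ {j = j} {l} j≢l with <-cmp (toℕ j) (toℕ l)
... | tri< j<l _ _ = trans (<ᵇ-false (<⇒≤ (opposite-reverses-< j<l))) (cong not (sym (<ᵇ-true j<l)))
... | tri≈ _ j≡l _ = ⊥-elim (j≢l (toℕ-injective j≡l))
... | tri> _ _ l<j = trans (<ᵇ-true (opposite-reverses-< l<j)) (cong not (sym (<ᵇ-false (<⇒≤ l<j))))

4<m*n⇒3≤m⊎3≤n : ∀ {m n} → 4 < m * n → 3 ≤ m ⊎ 3 ≤ n
4<m*n⇒3≤m⊎3≤n {m} {n} 4<m*n with 3 ≤? m | 3 ≤? n
... | yes 3≤m | _       = inj₁ 3≤m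
... | no _    | yes 3≤n = inj₂ 3≤n
... | no 3≰m  | no 3≰n  =
  contradiction 4<m*n (≤⇒≯ (*-mono-≤ (≤-pred (≰⇒> 3≰m)) (≤-pred (≰⇒> 3≰n))))

xor≡true⇒x≡true⊎y≡true : ∀ x {y} → x xor y ≡ true → x ≡ true ⊎ y ≡ true
xor≡true⇒x≡true⊎y≡true true  _      = inj₁ refl
xor≡true⇒x≡true⊎y≡true false y≡true = inj₂ y≡true

x≡not[y]⇒x≡false⊎y≡false : ∀ {x y} → x ≡ not y → x ≡ false ⊎ y ≡ false
x≡not[y]⇒x≡false⊎y≡false {false}         _ = inj₁ refl
x≡not[y]⇒x≡false⊎y≡false {true}  {false} _ = inj₂ refl
x≡not[y]⇒x≡false⊎y≡false {true}  {true}  ()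

xor-reflects : ∀ {P Q : Set} {x y} → Reflects P x → Reflects Q y →
               Reflects ((P × ¬ Q) ⊎ (¬ P × Q)) (x xor y)
xor-reflects (ofʸ p)  (ofʸ q)  = ofⁿ [ (λ (_ , ¬q) → ¬q q) , (λ (¬p , _) → ¬p p) ]′
xor-reflects (ofʸ p)  (ofⁿ ¬q) = ofʸ (inj₁ (p , ¬q))
xor-reflects (ofⁿ ¬p) (ofʸ q)  = ofʸ (inj₂ (¬p , q))
xor-reflects (ofⁿ ¬p) (ofⁿ ¬q) = ofⁿ [ (λ (p , _) → ¬p p) , (λ (_ , q) → ¬q q) ]′

Bool-pigeonhole₃ : (f : Fin 3 → Bool) → ∃₂ λ i j → i ≢ j × f i ≡ f j
Bool-pigeonhole₃ f
  with i , j , i<j , eq ← pigeonhole (s≤s (s≤s (s≤s z≤n))) (Inverse.from 2↔Bool ∘ f) =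
  i , j , <⇒≢ᶠ i<j , Injection.injective (↔⇒↣ (↔-sym 2↔Bool)) eq

between? : ℕ → ℕ → ℕ → Bool
between? a b c = (a <ᵇ c) xor (b <ᵇ c)

alternates? : ℕ → ℕ → ℕ → ℕ → Bool
alternates? a b c d = between? a b c xor between? a b d

between?-reflects : ∀ {a b c} → c ≢ a → c ≢ b → Reflects (StrictlyBetween a b c) (between? a b c)
between?-reflects {a} {b} {c} c≢a c≢b
  with a <ᵇ c | <ᵇ-reflects-< a c | b <ᵇ c | <ᵇ-reflects-< b c
... | true  | ofʸ a<c | true  | ofʸ b<c =
  ofⁿ λ (_ , c<a⊔b) → ≤⇒≯ (⊔-lub (<⇒≤ a<c) (<⇒≤ b<c)) c<a⊔b
... | true  | ofʸ a<c | false | ofⁿ b≮c =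
  ofʸ (≤-<-trans (m⊓n≤m a b) a<c , <-≤-trans (≤∧≢⇒< (≮⇒≥ b≮c) c≢b) (m≤n⊔m a b))
... | false | ofⁿ a≮c | true  | ofʸ b<c =
  ofʸ (≤-<-trans (m⊓n≤n a b) b<c , <-≤-trans (≤∧≢⇒< (≮⇒≥ a≮c) c≢a) (m≤m⊔n a b))
... | false | ofⁿ a≮c | false | ofⁿ b≮c =
  ofⁿ λ (a⊓b<c , _) → ≤⇒≯ (⊓-glb (≮⇒≥ a≮c) (≮⇒≥ b≮c)) a⊓b<c

alternates?-cong : ∀ {a a′ b b′ c c′ d d′} → a ≡ a′ → b ≡ b′ → c ≡ c′ → d ≡ d′ →
                   alternates? a b c d ≡ alternates? a′ b′ c′ d′
alternates?-cong refl refl refl refl = refl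

alternates?-parity : ∀ {a b c d} → b ≢ c → b ≢ d → c ≢ d →
                     alternates? a b c d xor (alternates? a c b d xor alternates? a d b c) ≡ true
alternates?-parity {a} {b} {c} {d} b≢c b≢d c≢d
  rewrite <ᵇ-flip b≢c | <ᵇ-flip b≢d | <ᵇ-flip c≢d =
  solve 6 (λ ab ac ad bc bd cd →
             ((ac :+ bc) :+ (ad :+ bd))
             :+ (((ab :+ (con true :+ bc)) :+ (ad :+ cd))
                 :+ ((ab :+ (con true :+ bd)) :+ (ac :+ (con true :+ cd))))
           := con true)
        refl (a <ᵇ b) (a <ᵇ c) (a <ᵇ d) (b <ᵇ c) (b <ᵇ d) (c <ᵇ d)
  where open xor-∧-Solver

same-side⇒cross-alternates : ∀ {a b c d} → b ≢ c → b ≢ d → c ≢ d → between? a b c ≡ between? a b d →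
                             alternates? a c b d ≡ true ⊎ alternates? a d b c ≡ true
same-side⇒cross-alternates {a} {b} {c} {d} b≢c b≢d c≢d same =
  xor≡true⇒x≡true⊎y≡true (alternates? a c b d)
    (subst (λ x → x xor (alternates? a c b d xor alternates? a d b c) ≡ true) not-alternating
           (alternates?-parity b≢c b≢d c≢d))
  where
    not-alternating : alternates? a b c d ≡ false
    not-alternating = trans (cong (_xor between? a b d) same) (xor-same (between? a b d))

alternates?-blocks : ∀ {M a c} r s → a < M → c < M →
                     alternates? a (M + r) c (M + s) ≡ (a <ᵇ c) xor not (r <ᵇ s)
alternates?-blocks {M} {a} {c} r s a<M c<M
  rewrite <ᵇ-false (≤-trans (<⇒≤ c<M) (m≤m+n M r)) | <ᵇ-true (<-≤-trans a<M (m≤m+n M s))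
        | +-<ᵇ M {r} {s} | xor-identityʳ (a <ᵇ c) = refl

-- Definitionally the position function inside Alternate, which Alternate-reflects relies on.
pos : ∀ {N} → CircOrder N → Fin N → ℕ
pos σ v = toℕ (σ ⟨$⟩ʳ v)

pos-≢ : ∀ {N} (σ : CircOrder N) {u v} → u ≢ v → pos σ u ≢ pos σ v
pos-≢ σ u≢v = u≢v ∘ Injection.injective (↔⇒↣ σ) ∘ toℕ-injective

alternatesIn? : ∀ {N} → CircOrder N → (x y z w : Fin N) → Bool
alternatesIn? σ x y z w = alternates? (pos σ x) (pos σ y) (pos σ z) (pos σ w)

Alternate-reflects : ∀ {N} (G : Graph N) (σ : CircOrder N) {x y z w} → NonincidentEdges G x y z w →
                     Reflects (Alternate σ x y z w) (alternatesIn? σ x y z w)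
Alternate-reflects G σ (_ , _ , x≢z , x≢w , y≢z , y≢w) =
  xor-reflects (between?-reflects (pos-≢ σ (x≢z ∘ sym)) (pos-≢ σ (y≢z ∘ sym)))
               (between?-reflects (pos-≢ σ (x≢w ∘ sym)) (pos-≢ σ (y≢w ∘ sym)))

Separates⇒alternatesIn?≡false : ∀ {N} (G : Graph N) (σ : CircOrder N) {x y z w} →
                                NonincidentEdges G x y z w → Separates σ x y z w → alternatesIn? σ x y z w ≡ false
Separates⇒alternatesIn?≡false G σ e sep = det (Alternate-reflects G σ e) (ofⁿ sep)

alternatesIn?≡false⇒Separates : ∀ {N} (G : Graph N) (σ : CircOrder N) {x y z w} →
                                NonincidentEdges G x y z w → alternatesIn? σ x y z w ≡ false → Separates σ x y z w
alternatesIn?≡false⇒Separates G σ e eq = invert (subst (Reflects _) eq (Alternate-reflects G σ e))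

SeparatesAll : ∀ {N} → Graph N → CircOrder N → Set
SeparatesAll {N} G σ = ∀ (x y z w : Fin N) → NonincidentEdges G x y z w → Separates σ x y z w

adjacent⇒≢ : ∀ {N} (G : Graph N) {x y} → Adj G x y → x ≢ y
adjacent⇒≢ G xy refl = irrAdj G xy

separatesAll⇒opposite-sides : ∀ {N} (G : Graph N) (σ : CircOrder N) → SeparatesAll G σ →
  ∀ {u₁ u₂ c d} → u₁ ≢ u₂ → c ≢ d → Adj G u₁ c → Adj G u₁ d → Adj G u₂ c → Adj G u₂ d →
  between? (pos σ u₁) (pos σ u₂) (pos σ c) ≢ between? (pos σ u₁) (pos σ u₂) (pos σ d)
separatesAll⇒opposite-sides G σ S {u₁} {u₂} u₁≢u₂ c≢d u₁c u₁d u₂c u₂d same =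
  [ never-alternates u₁c u₂d u₁d u₂c c≢d , never-alternates u₁d u₂c u₁c u₂d (c≢d ∘ sym) ]′
    (same-side⇒cross-alternates (pos-≢ σ (adjacent⇒≢ G u₂c)) (pos-≢ σ (adjacent⇒≢ G u₂d))
                                (pos-≢ σ c≢d) same)
  where
    never-alternates : ∀ {c d} → Adj G u₁ c → Adj G u₂ d → Adj G u₁ d → Adj G u₂ c → c ≢ d →
                       alternatesIn? σ u₁ c u₂ d ≢ true
    never-alternates u₁c u₂d u₁d u₂c c≢d alt =
      contradiction (trans (sym alt) (Separates⇒alternatesIn?≡false G σ e (S _ _ _ _ e))) λ ()
      where e = u₁c , u₂d , u₁≢u₂ , adjacent⇒≢ G u₁d , adjacent⇒≢ G u₂c ∘ sym , c≢d

record Biclique {N} (G : Graph N) (p q : ℕ) : Set where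
  field
    left            : Fin p → Fin N
    right           : Fin q → Fin N
    left-injective  : Injective _≡_ _≡_ left
    right-injective : Injective _≡_ _≡_ right
    adjacent        : ∀ i j → Adj G (left i) (right j)

Biclique-swap : ∀ {N} {G : Graph N} {p q} → Biclique G p q → Biclique G q p
Biclique-swap {G = G} B = record
  { left            = right
  ; right           = left
  ; left-injective  = right-injective
  ; right-injective = left-injective
  ; adjacent        = λ j i → symAdj G (adjacent i j)
  }
  where open Biclique B

biclique₂,₃⇒¬separatesAll : ∀ {N} {G : Graph N} → Biclique G 2 3 → (σ : CircOrder N) → ¬ SeparatesAll G σ
biclique₂,₃⇒¬separatesAll {G = G} B σ S =
  let i , j , i≢j , same = Bool-pigeonhole₃ side in
  separatesAll⇒opposite-sides G σ S ((λ ()) ∘ left-injective) (i≢j ∘ right-injective)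
    (adjacent 0F i) (adjacent 0F j) (adjacent 1F i) (adjacent 1F j) same
  where
    open Biclique B
    side : Fin 3 → Bool
    side j = between? (pos σ (left 0F)) (pos σ (left 1F)) (pos σ (right j))

biclique₂,₃⇒noCircSepFamily<2 : ∀ {N} {G : Graph N} → Biclique G 2 3 →
                                ∀ k → k < 2 → ¬ HasCircSepFamilyOfSize G k
biclique₂,₃⇒noCircSepFamily<2 {G = G} B zero _ (_ , F) = ¬Fin0 (proj₁ (F _ _ _ _ nonincident))
  where
    open Biclique B
    nonincident : NonincidentEdges G (left 0F) (right 0F) (left 1F) (right 1F)
    nonincident = adjacent 0F 0F , adjacent 1F 1F , (λ ()) ∘ left-injective , adjacent⇒≢ G (adjacent 0F 1F)
                , adjacent⇒≢ G (adjacent 1F 0F) ∘ sym , (λ ()) ∘ right-injective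
biclique₂,₃⇒noCircSepFamily<2 {G = G} B (suc zero) _ (σ ∷ [] , F) = biclique₂,₃⇒¬separatesAll B σ S
  where
    S : SeparatesAll G σ
    S x y z w e with F x y z w e
    ... | 0F , sep = sep
biclique₂,₃⇒noCircSepFamily<2 B (suc (suc _)) (s≤s (s≤s ()))

Unalternated : ∀ {N k} → Vec (CircOrder N) k → (x y z w : Fin N) → Set
Unalternated σs x y z w = ∃ λ t → alternatesIn? (lookup σs t) x y z w ≡ false

Unalternated-swapˡ : ∀ {N k} (σs : Vec (CircOrder N) k) {x y z w} →
                     Unalternated σs x y z w → Unalternated σs y x z w
Unalternated-swapˡ σs {x} {y} {z} {w} = map₂ λ {t} → let p = pos (lookup σs t) in
  trans (cong₂ _xor_ (xor-comm (p y <ᵇ p z) (p x <ᵇ p z)) (xor-comm (p y <ᵇ p w) (p x <ᵇ p w)))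

Unalternated-swapʳ : ∀ {N k} (σs : Vec (CircOrder N) k) {x y z w} →
                     Unalternated σs x y z w → Unalternated σs x y w z
Unalternated-swapʳ σs {x} {y} {z} {w} = map₂ λ {t} → let p = pos (lookup σs t) in
  trans (xor-comm (between? (p x) (p y) (p w)) (between? (p x) (p y) (p z)))

Unalternated⇒Separated : ∀ {N k} (G : Graph N) (σs : Vec (CircOrder N) k) {x y z w} →
                         NonincidentEdges G x y z w → Unalternated σs x y z w →
                         ∃ λ t → Separates (lookup σs t) x y z w
Unalternated⇒Separated G σs e = map₂ λ {t} → alternatesIn?≡false⇒Separates G (lookup σs t) e

inFirstPart-↑ˡ : ∀ m {n} (i : Fin m) → inFirstPart m (i ↑ˡ n) ≡ true
inFirstPart-↑ˡ m {n} i rewrite splitAt-↑ˡ m i n = refl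

inFirstPart-↑ʳ : ∀ m {n} (j : Fin n) → inFirstPart m (m ↑ʳ j) ≡ false
inFirstPart-↑ʳ m {n} j rewrite splitAt-↑ʳ m n j = refl

K-adjacent : ∀ {m n} (i : Fin m) (j : Fin n) → Adj (K m n) (i ↑ˡ n) (m ↑ʳ j)
K-adjacent {m} i j eq =
  contradiction (trans (sym (inFirstPart-↑ˡ m i)) (trans eq (inFirstPart-↑ʳ m j))) λ ()

K-biclique : ∀ {m n p q} → p ≤ m → q ≤ n → Biclique (K m n) p q
K-biclique {m} {n} p≤m q≤n = record
  { left            = λ i → inject≤ i p≤m ↑ˡ n
  ; right           = λ j → m ↑ʳ inject≤ j q≤n
  ; left-injective  = inject≤-injective p≤m p≤m _ _ ∘ ↑ˡ-injective n _ _
  ; right-injective = inject≤-injective q≤n q≤n _ _ ∘ ↑ʳ-injective m _ _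
  ; adjacent        = λ i j → K-adjacent (inject≤ i p≤m) (inject≤ j q≤n)
  }

data Part (m n : ℕ) : Fin (m + n) → Set where
  first  : (i : Fin m) → Part m n (i ↑ˡ n)
  second : (j : Fin n) → Part m n (m ↑ʳ j)

part : ∀ m n (v : Fin (m + n)) → Part m n v
part m n v with splitAt m v in eq
... | inj₁ i = subst (Part m n) (splitAt⁻¹-↑ˡ eq) (first i)
... | inj₂ j = subst (Part m n) (splitAt⁻¹-↑ʳ eq) (second j)

data CrossEdge (m n : ℕ) : Fin (m + n) → Fin (m + n) → Set where
  first-second : (i : Fin m) (j : Fin n) → CrossEdge m n (i ↑ˡ n) (m ↑ʳ j)
  second-first : (i : Fin m) (j : Fin n) → CrossEdge m n (m ↑ʳ j) (i ↑ˡ n)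

K-edge : ∀ {m n x y} → Adj (K m n) x y → CrossEdge m n x y
K-edge {m} {n} {x} {y} xy with part m n x | part m n y
... | first i  | first k  = ⊥-elim (xy (trans (inFirstPart-↑ˡ m i) (sym (inFirstPart-↑ˡ m k))))
... | first i  | second j = first-second i j
... | second j | first i  = second-first i j
... | second j | second l = ⊥-elim (xy (trans (inFirstPart-↑ʳ m j) (sym (inFirstPart-↑ʳ m l))))

rightAction : ∀ m n → Permutation′ n → CircOrder (m + n)
rightAction _ _ τ = ↔-trans +↔⊎ (↔-trans (↔-refl ⊎-↔ τ) (↔-sym +↔⊎))

pos-rightAction-↑ˡ : ∀ {m n} (τ : Permutation′ n) (i : Fin m) → pos (rightAction m n τ) (i ↑ˡ n) ≡ toℕ i
pos-rightAction-↑ˡ {m} {n} τ i rewrite splitAt-↑ˡ m i n = toℕ-↑ˡ i n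

pos-rightAction-↑ʳ : ∀ {m n} (τ : Permutation′ n) (j : Fin n) →
                     pos (rightAction m n τ) (m ↑ʳ j) ≡ m + toℕ (τ ⟨$⟩ʳ j)
pos-rightAction-↑ʳ {m} {n} τ j rewrite splitAt-↑ʳ m n j = toℕ-↑ʳ m (τ ⟨$⟩ʳ j)

alternatesIn?-rightAction : ∀ {m n} (τ : Permutation′ n) (i k : Fin m) (j l : Fin n) →
  alternatesIn? (rightAction m n τ) (i ↑ˡ n) (m ↑ʳ j) (k ↑ˡ n) (m ↑ʳ l) ≡
  (toℕ i <ᵇ toℕ k) xor not (toℕ (τ ⟨$⟩ʳ j) <ᵇ toℕ (τ ⟨$⟩ʳ l))
alternatesIn?-rightAction {m} τ i k j l =
  trans (alternates?-cong (pos-rightAction-↑ˡ τ i) (pos-rightAction-↑ʳ {m} τ j)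
                          (pos-rightAction-↑ˡ τ k) (pos-rightAction-↑ʳ {m} τ l))
        (alternates?-blocks _ _ (toℕ<n i) (toℕ<n k))

rightAction-id-reverse : ∀ {m n} (i k : Fin m) {j l : Fin n} → j ≢ l →
  alternatesIn? (rightAction m n id) (i ↑ˡ n) (m ↑ʳ j) (k ↑ˡ n) (m ↑ʳ l) ≡
  not (alternatesIn? (rightAction m n reverse) (i ↑ˡ n) (m ↑ʳ j) (k ↑ˡ n) (m ↑ʳ l))
rightAction-id-reverse {m} {n} i k {j} {l} j≢l = begin
  cross (rightAction m n id)          ≡⟨ alternatesIn?-rightAction id i k j l ⟩
  i<k xor not j<l                     ≡⟨ cong (i<k xor_) (opposite-<ᵇ j≢l) ⟨
  i<k xor opp-j<l                     ≡⟨ cong (i<k xor_) (not-involutive opp-j<l) ⟨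
  i<k xor not (not opp-j<l)           ≡⟨ not-distribʳ-xor i<k (not opp-j<l) ⟨
  not (i<k xor not opp-j<l)           ≡⟨ cong not (alternatesIn?-rightAction reverse i k j l) ⟨
  not (cross (rightAction m n reverse)) ∎
  where
    open ≡-Reasoning
    i<k = toℕ i <ᵇ toℕ k
    j<l = toℕ j <ᵇ toℕ l
    opp-j<l = toℕ (opposite j) <ᵇ toℕ (opposite l)
    cross : CircOrder (m + n) → Bool
    cross σ = alternatesIn? σ (i ↑ˡ n) (m ↑ʳ j) (k ↑ˡ n) (m ↑ʳ l)

K-orderings : ∀ m n → Vec (CircOrder (m + n)) 2
K-orderings m n = rightAction m n id ∷ rightAction m n reverse ∷ []

K-crossEdges-unalternated : ∀ {m n} (i k : Fin m) {j l : Fin n} → j ≢ l →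
                            Unalternated (K-orderings m n) (i ↑ˡ n) (m ↑ʳ j) (k ↑ˡ n) (m ↑ʳ l)
K-crossEdges-unalternated i k j≢l =
  [ (0F ,_) , (1F ,_) ]′ (x≡not[y]⇒x≡false⊎y≡false (rightAction-id-reverse i k j≢l))

K-nonincident-unalternated : ∀ {m n x y z w} → NonincidentEdges (K m n) x y z w →
                             Unalternated (K-orderings m n) x y z w
K-nonincident-unalternated {m} {n} (xy , zw , x≢z , x≢w , y≢z , y≢w) with K-edge xy | K-edge zw
... | first-second i j | first-second k l =
  K-crossEdges-unalternated i k (y≢w ∘ cong (m ↑ʳ_))
... | first-second i j | second-first k l =
  Unalternated-swapʳ (K-orderings m n) (K-crossEdges-unalternated i k (y≢z ∘ cong (m ↑ʳ_)))
... | second-first i j | first-second k l =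
  Unalternated-swapˡ (K-orderings m n) (K-crossEdges-unalternated i k (x≢w ∘ cong (m ↑ʳ_)))
... | second-first i j | second-first k l =
  Unalternated-swapˡ (K-orderings m n)
    (Unalternated-swapʳ (K-orderings m n) (K-crossEdges-unalternated i k (x≢z ∘ cong (m ↑ʳ_))))

K-isCircSepFamily : ∀ m n → IsCircSepFamily (K m n) (K-orderings m n)
K-isCircSepFamily m n x y z w e =
  Unalternated⇒Separated (K m n) (K-orderings m n) e (K-nonincident-unalternated e)

mainTheorem15 : ∀ (m n : ℕ) → 2 ≤ m → 2 ≤ n → 4 < m * n → CircSepDim≡ (K m n) 2
mainTheorem15 m n 2≤m 2≤n 4<m*n =
  (K-orderings m n , K-isCircSepFamily m n) , biclique₂,₃⇒noCircSepFamily<2 K₂,₃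
  where
    K₂,₃ : Biclique (K m n) 2 3
    K₂,₃ = [ (λ 3≤m → Biclique-swap (K-biclique 3≤m 2≤n)) , K-biclique 2≤m ]′ (4<m*n⇒3≤m⊎3≤n 4<m*n)
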